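{- For all $n\ge1$, $c_{2n+1}<b_{2n+1}$, where $b_k$ (resp. $c_k$) denotes the number of permutations of $[k]$ all of whose peaks and valleys are even (resp. odd).
   Context: For a permutation $\pi=\pi_1\cdots\pi_k$, an index $i$ ($2\le i\le k-1$) is a peak if $\pi_{i-1}<\pi_i>\pi_{i+1}$ and a valley if $\pi_{i-1}>\pi_i<\pi_{i+1}$. -}

module Defs where

open import Data.Nat using (ℕ; zero; suc; _+_; _<_; _<ᵇ_)
open import Data.Bool using (Bool; true; false; _∧_; _∨_; not; if_then_else_)
open import Data.List using (List; []; _∷_; map; concatMap; length; filterᵇ)

isEven : ℕ → Bool
isEven zero = true
isEven (suc n) = not (isEven n)

insertions : ℕ → List ℕ → List (List ℕ)
insertions x [] = (x ∷ []) ∷ []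
insertions x (y ∷ ys) = (x ∷ y ∷ ys) ∷ map (y ∷_) (insertions x ys)

perms : ℕ → List (List ℕ)
perms zero = [] ∷ []
perms (suc k) = concatMap (insertions (suc k)) (perms k)

peakOrValley : ℕ → ℕ → ℕ → Bool
peakOrValley a b c = ((a <ᵇ b) ∧ (c <ᵇ b)) ∨ ((b <ᵇ a) ∧ (b <ᵇ c))

-- go i π : checks every interior index j ≥ i of the remaining word
-- (the head of the word sits at index i-1); P is applied to the index
allPV : (ℕ → Bool) → ℕ → List ℕ → Bool
allPV P i (a ∷ b ∷ c ∷ rest) =
  (if peakOrValley a b c then P i else true) ∧ allPV P (suc i) (b ∷ c ∷ rest)
allPV P i _ = true

allPeaksValleys : (ℕ → Bool) → List ℕ → Bool
allPeaksValleys P π = allPV P 2 π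

b : ℕ → ℕ
b k = length (filterᵇ (allPeaksValleys isEven) (perms k))

c : ℕ → ℕ
c k = length (filterᵇ (allPeaksValleys (λ i → not (isEven i))) (perms k))

-- Rotating the first letter of a permutation to the end lowers the index of every old
-- interior position by one and creates a single new interior position k − 1.  For odd
-- k, k − 1 is even, so rotation maps the permutations whose peaks and valleys are all
-- odd injectively into those whose peaks and valleys are all even.  The permutation
-- k ⋯ 3 1 2 lies in the latter set but not in the image: its preimage 2 k ⋯ 3 1 has a
-- peak at the even index 2.
module Submission where

open import Defs
open import Data.Bool using (Bool; true; false; _∧_; not; if_then_else_; T; T?)
open import Data.Bool.Properties using (T-∧; T-≡; not-involutive)
open import Data.Empty using (⊥-elim)
open import Data.List using (List; []; _∷_; _++_; _∷ʳ_; map; concatMap; length; filterᵇ; applyDownFrom)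
open import Data.List.Membership.Propositional using (_∈_; _∉_; find; lose)
open import Data.List.Membership.Propositional.Properties
  using (∈-∃++; ∈-map⁺; ∈-map⁻; ∈-concatMap⁺; ∈-concatMap⁻; ∈-filter⁺; ∈-filter⁻)
open import Data.List.Properties using (∷ʳ-injective; length-map; length-applyDownFrom)
open import Data.List.Relation.Binary.Permutation.Propositional using (_↭_; refl; prep; swap; trans; ↭-sym)
open import Data.List.Relation.Binary.Permutation.Propositional.Properties
  using (∈-resp-↭; ↭-length; drop-mid; shift; ∷↭∷ʳ)
open import Data.List.Relation.Binary.Subset.Propositional using (_⊆_)
import Data.List.Relation.Unary.All as All
open import Data.List.Relation.Unary.Any using (here; there)
open import Data.List.Relation.Unary.Unique.Propositional using (Unique; []; _∷_)
import Data.List.Relation.Unary.Unique.Propositional.Properties as Unique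
open import Data.Nat using (ℕ; zero; suc; _+_; _*_; _∸_; _≤_; _<_; _<ᵇ_; _≟_; z≤n; s≤s)
open import Data.Nat.Properties using (+-comm; +-suc; +-identityʳ; *-suc; ≤-refl; ≤-trans; n≤1+n; 1+n≰n; <⇒<ᵇ)
open import Data.Product using (_,_; proj₂)
open import Data.Unit using (tt)
open import Function using (_∘_; Injective)
open import Function.Bundles using (Equivalence)
open import Relation.Binary.PropositionalEquality using (_≡_; _≢_; refl; sym; cong; cong₂; subst)
  renaming (trans to ≡-trans)
open import Relation.Nullary using (yes; no; ¬_)

T-∧-intro : ∀ {x y} → T x → T y → T (x ∧ y)
T-∧-intro p q = Equivalence.from T-∧ (p , q)

T-if-else-true : ∀ X {Q} → T Q → T (if X then Q else true)
T-if-else-true true q = q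
T-if-else-true false _ = tt

T-if-false : ∀ {X} Q → X ≡ false → T (if X then Q else true)
T-if-false Q refl = tt

n<ᵇ1+n : ∀ n → (n <ᵇ suc n) ≡ true
n<ᵇ1+n n = Equivalence.to T-≡ (<⇒<ᵇ {n} ≤-refl)

isEven-2* : ∀ n → T (isEven (2 * n))
isEven-2* zero = tt
isEven-2* (suc n) =
  subst (T ∘ isEven) (sym (*-suc 2 n))
    (subst T (sym (not-involutive (isEven (2 * n)))) (isEven-2* n))

module _ {A : Set} where

  Unique-⊆⇒length≤ : {xs ys : List A} → Unique xs → xs ⊆ ys → length xs ≤ length ys
  Unique-⊆⇒length≤ {[]} _ _ = z≤n
  Unique-⊆⇒length≤ {x ∷ xs} (x∉xs ∷ uxs) xs⊆ys with ∈-∃++ (xs⊆ys (here refl))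
  ... | as , bs , refl = subst (suc (length xs) ≤_) (sym (↭-length (shift x as bs)))
                           (s≤s (Unique-⊆⇒length≤ uxs xs⊆as++bs))
    where
    xs⊆as++bs : xs ⊆ as ++ bs
    xs⊆as++bs z∈xs with ∈-resp-↭ (shift x as bs) (xs⊆ys (there z∈xs))
    ... | here refl = ⊥-elim (All.lookup x∉xs z∈xs refl)
    ... | there z∈as++bs = z∈as++bs

module _ {A B : Set} where

  injection-missing⇒length< : {xs : List A} {ys : List B} {y : B} (f : A → B) → Injective _≡_ _≡_ f →
    Unique xs → (∀ {x} → x ∈ xs → f x ∈ ys) → y ∈ ys → (∀ {x} → x ∈ xs → f x ≢ y) →
    length xs < length ys
  injection-missing⇒length< {xs} {ys} {y} f f-inj uxs maps y∈ys missed =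
    subst (λ n → suc n ≤ length ys) (length-map f xs)
      (Unique-⊆⇒length≤ (All.tabulate y∉image ∷ Unique.map⁺ f-inj uxs) y∷image⊆ys)
    where
    y∉image : ∀ {z} → z ∈ map f xs → y ≢ z
    y∉image z∈image y≡z with ∈-map⁻ f z∈image
    ... | x , x∈xs , refl = missed x∈xs (sym y≡z)
    y∷image⊆ys : y ∷ map f xs ⊆ ys
    y∷image⊆ys (here refl) = y∈ys
    y∷image⊆ys (there z∈image) with ∈-map⁻ f z∈image
    ... | x , x∈xs , refl = maps x∈xs

  concatMap-unique : (f : A → List B) {ps : List A} → Unique ps →
    (∀ {p} → p ∈ ps → Unique (f p)) →
    (∀ {p q l} → p ∈ ps → q ∈ ps → l ∈ f p → l ∈ f q → p ≡ q) →
    Unique (concatMap f ps)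
  concatMap-unique f {[]} _ _ _ = []
  concatMap-unique f {p ∷ ps} (p∉ps ∷ ups) uf disjoint =
    Unique.++⁺ (uf (here refl))
      (concatMap-unique f ups (uf ∘ there) (λ p q → disjoint (there p) (there q)))
      λ (l∈fp , l∈rest) → let q , q∈ps , l∈fq = find (∈-concatMap⁻ f {xs = ps} l∈rest)
                          in All.lookup p∉ps q∈ps (disjoint (here refl) (there q∈ps) l∈fp l∈fq)

insertions-↭ : ∀ x p {l} → l ∈ insertions x p → l ↭ x ∷ p
insertions-↭ x [] (here refl) = refl
insertions-↭ x (y ∷ ys) (here refl) = refl
insertions-↭ x (y ∷ ys) (there l∈) with ∈-map⁻ (y ∷_) l∈
... | l , l∈ins , refl = trans (prep y (insertions-↭ x ys l∈ins)) (swap y x refl)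

∈-insertions : ∀ x as bs → as ++ x ∷ bs ∈ insertions x (as ++ bs)
∈-insertions x [] [] = here refl
∈-insertions x [] (b ∷ bs) = here refl
∈-insertions x (a ∷ as) bs = there (∈-map⁺ (a ∷_) (∈-insertions x as bs))

insertions-unique : ∀ x p → x ∉ p → Unique (insertions x p)
insertions-unique x [] _ = All.[] ∷ []
insertions-unique x (y ∷ ys) x∉p =
  All.tabulate head-new ∷ Unique.map⁺ ∷-injectiveʳ (insertions-unique x ys (x∉p ∘ there))
  where
  ∷-injectiveʳ : ∀ {u v : List ℕ} → y ∷ u ≡ y ∷ v → u ≡ v
  ∷-injectiveʳ refl = refl
  head-new : ∀ {l} → l ∈ map (y ∷_) (insertions x ys) → x ∷ y ∷ ys ≢ l
  head-new l∈ eq with ∈-map⁻ (y ∷_) l∈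
  head-new l∈ refl | _ , _ , refl = x∉p (here refl)

delete : ℕ → List ℕ → List ℕ
delete x [] = []
delete x (y ∷ ys) with x ≟ y
... | yes _ = ys
... | no _ = y ∷ delete x ys

delete-insertions : ∀ x p {l} → x ∉ p → l ∈ insertions x p → delete x l ≡ p
delete-insertions x [] _ (here refl) with x ≟ x
... | yes _ = refl
... | no x≢x = ⊥-elim (x≢x refl)
delete-insertions x (y ∷ ys) _ (here refl) with x ≟ x
... | yes _ = refl
... | no x≢x = ⊥-elim (x≢x refl)
delete-insertions x (y ∷ ys) x∉p (there l∈) with ∈-map⁻ (y ∷_) l∈
... | l , l∈ins , refl with x ≟ y
...   | yes refl = ⊥-elim (x∉p (here refl))
...   | no _ = cong (y ∷_) (delete-insertions x ys (x∉p ∘ there) l∈ins)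

∈-perms⁻ : ∀ k {π} → π ∈ perms k → π ↭ applyDownFrom suc k
∈-perms⁻ zero (here refl) = refl
∈-perms⁻ (suc k) π∈ with find (∈-concatMap⁻ (insertions (suc k)) {xs = perms k} π∈)
... | p , p∈ , π∈ins = trans (insertions-↭ (suc k) p π∈ins) (prep (suc k) (∈-perms⁻ k p∈))

∈-perms⁺ : ∀ k {π} → π ↭ applyDownFrom suc k → π ∈ perms k
∈-perms⁺ zero π↭ with ↭-length π↭
∈-perms⁺ zero {[]} π↭ | refl = here refl
∈-perms⁺ (suc k) π↭ with ∈-∃++ (∈-resp-↭ (↭-sym π↭) (here refl))
... | as , bs , refl = ∈-concatMap⁺ (insertions (suc k)) {xs = perms k}
       (lose (∈-perms⁺ k (drop-mid as [] π↭)) (∈-insertions (suc k) as bs))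

∈-applyDownFrom-suc⇒≤ : ∀ k {y} → y ∈ applyDownFrom suc k → y ≤ k
∈-applyDownFrom-suc⇒≤ (suc k) (here refl) = ≤-refl
∈-applyDownFrom-suc⇒≤ (suc k) (there y∈) = ≤-trans (∈-applyDownFrom-suc⇒≤ k y∈) (n≤1+n k)

perms-unique : ∀ k → Unique (perms k)
perms-unique zero = All.[] ∷ []
perms-unique (suc k) =
  concatMap-unique (insertions (suc k)) (perms-unique k)
    (λ {p} p∈ → insertions-unique (suc k) p (fresh p∈))
    (λ {p} {q} p∈ q∈ l∈p l∈q → ≡-trans (sym (delete-insertions (suc k) p (fresh p∈) l∈p))
                                       (delete-insertions (suc k) q (fresh q∈) l∈q))
  where
  fresh : ∀ {p} → p ∈ perms k → suc k ∉ p
  fresh p∈ k+1∈p = 1+n≰n (∈-applyDownFrom-suc⇒≤ k (∈-resp-↭ (∈-perms⁻ k p∈) k+1∈p))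

rotate : List ℕ → List ℕ
rotate [] = []
rotate (a ∷ t) = t ∷ʳ a

rotate-↭ : ∀ π → rotate π ↭ π
rotate-↭ [] = refl
rotate-↭ (a ∷ t) = ↭-sym (∷↭∷ʳ a t)

rotate-injective : Injective _≡_ _≡_ rotate
rotate-injective {[]} {[]} _ = refl
rotate-injective {[]} {_ ∷ []} ()
rotate-injective {[]} {_ ∷ _ ∷ _} ()
rotate-injective {_ ∷ []} {[]} ()
rotate-injective {_ ∷ _ ∷ _} {[]} ()
rotate-injective {a ∷ t} {a′ ∷ t′} eq with ∷ʳ-injective t t′ eq
... | refl , refl = refl

allPV-cong : ∀ {P Q : ℕ → Bool} → (∀ j → P j ≡ Q j) → ∀ i π → allPV P i π ≡ allPV Q i π
allPV-cong P≡Q i (x ∷ y ∷ z ∷ t) =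
  cong₂ (λ u v → (if peakOrValley x y z then u else true) ∧ v)
        (P≡Q i) (allPV-cong P≡Q (suc i) (y ∷ z ∷ t))
allPV-cong P≡Q i [] = refl
allPV-cong P≡Q i (_ ∷ []) = refl
allPV-cong P≡Q i (_ ∷ _ ∷ []) = refl

allPV-suc : ∀ (P : ℕ → Bool) i π → allPV P (suc i) π ≡ allPV (P ∘ suc) i π
allPV-suc P i (x ∷ y ∷ z ∷ t) rewrite allPV-suc P (suc i) (y ∷ z ∷ t) = refl
allPV-suc P i [] = refl
allPV-suc P i (_ ∷ []) = refl
allPV-suc P i (_ ∷ _ ∷ []) = refl

allPV-∷ʳ : ∀ (P : ℕ → Bool) i x y t a →
  T (allPV P i (x ∷ y ∷ t)) → T (P (i + length t)) → T (allPV P i (x ∷ y ∷ t ∷ʳ a))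
allPV-∷ʳ P i x y [] a _ p rewrite +-identityʳ i =
  T-∧-intro (T-if-else-true (peakOrValley x y a) p) tt
allPV-∷ʳ P i x y (z ∷ t) a h p with Equivalence.to T-∧ h
... | first , rest =
  T-∧-intro first (allPV-∷ʳ P (suc i) y z t a rest (subst (T ∘ P) (+-suc i (length t)) p))

allPeaksValleys-rotate : ∀ (P Q : ℕ → Bool) → (∀ j → Q (suc j) ≡ P j) → ∀ π →
  T (allPeaksValleys Q π) → T (P (length π ∸ 1)) → T (allPeaksValleys P (rotate π))
allPeaksValleys-rotate P Q Q∘suc≡P (a ∷ x ∷ y ∷ t) h p =
  allPV-∷ʳ P 2 x y t a
    (subst T (≡-trans (allPV-suc Q 2 (x ∷ y ∷ t)) (allPV-cong Q∘suc≡P 2 (x ∷ y ∷ t)))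
           (proj₂ (Equivalence.to T-∧ h)))
    p
allPeaksValleys-rotate P Q _ [] _ _ = tt
allPeaksValleys-rotate P Q _ (_ ∷ []) _ _ = tt
allPeaksValleys-rotate P Q _ (_ ∷ _ ∷ []) _ _ = tt

oddPeaksValleys : List ℕ → Bool
oddPeaksValleys = allPeaksValleys (λ i → not (isEven i))

evenPeaksValleys : List ℕ → Bool
evenPeaksValleys = allPeaksValleys isEven

descendingWithout2 : ℕ → List ℕ
descendingWithout2 zero = 1 ∷ []
descendingWithout2 (suc m) = 3 + m ∷ descendingWithout2 m

2∷descendingWithout2-↭ : ∀ m → 2 ∷ descendingWithout2 m ↭ applyDownFrom suc (2 + m)
2∷descendingWithout2-↭ zero = refl
2∷descendingWithout2-↭ (suc m) =
  trans (swap 2 (3 + m) refl) (prep (3 + m) (2∷descendingWithout2-↭ m))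

descending-not-peakOrValley : ∀ n → peakOrValley (2 + n) (1 + n) n ≡ false
descending-not-peakOrValley zero = refl
descending-not-peakOrValley (suc n) = descending-not-peakOrValley n

rotate-2∷descendingWithout2-allPV : ∀ (P : ℕ → Bool) i m →
  T (P (i + m)) → T (allPV P i (rotate (2 ∷ descendingWithout2 (suc m))))
rotate-2∷descendingWithout2-allPV P i zero p rewrite +-identityʳ i = T-∧-intro p tt
rotate-2∷descendingWithout2-allPV P i (suc zero) p =
  T-∧-intro tt (rotate-2∷descendingWithout2-allPV P (suc i) zero (subst (T ∘ P) (+-suc i 0) p))
rotate-2∷descendingWithout2-allPV P i (suc (suc m)) p =
  T-∧-intro (T-if-false (P i) (descending-not-peakOrValley (3 + m)))
            (rotate-2∷descendingWithout2-allPV P (suc i) (suc m) (subst (T ∘ P) (+-suc i (suc m)) p))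

2∷descendingWithout2-peak-at-2 : ∀ m → ¬ T (oddPeaksValleys (2 ∷ descendingWithout2 (suc m)))
2∷descendingWithout2-peak-at-2 zero ()
2∷descendingWithout2-peak-at-2 (suc m) rewrite n<ᵇ1+n m = λ ()

c<b-when-2+m-even : ∀ m → T (isEven (2 + m)) → c (3 + m) < b (3 + m)
c<b-when-2+m-even m even =
  injection-missing⇒length< rotate rotate-injective
    (Unique.filter⁺ (T? ∘ oddPeaksValleys) (perms-unique k)) rotate-maps witness-∈ witness-not-image
  where
  k = 3 + m
  witness = rotate (2 ∷ descendingWithout2 (suc m))

  rotate-maps : ∀ {π} → π ∈ filterᵇ oddPeaksValleys (perms k) →
                rotate π ∈ filterᵇ evenPeaksValleys (perms k)
  rotate-maps {π} π∈ with ∈-filter⁻ (T? ∘ oddPeaksValleys) {xs = perms k} π∈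
  ... | π∈perms , odd =
    ∈-filter⁺ (T? ∘ evenPeaksValleys) (∈-perms⁺ k (trans (rotate-↭ π) π↭))
      (allPeaksValleys-rotate isEven (not ∘ isEven) (not-involutive ∘ isEven) π odd
        (subst (T ∘ isEven ∘ (_∸ 1)) (sym length-π) even))
    where
    π↭ = ∈-perms⁻ k π∈perms
    length-π : length π ≡ k
    length-π = ≡-trans (↭-length π↭) (length-applyDownFrom suc k)

  witness-∈ : witness ∈ filterᵇ evenPeaksValleys (perms k)
  witness-∈ = ∈-filter⁺ (T? ∘ evenPeaksValleys)
    (∈-perms⁺ k (trans (rotate-↭ _) (2∷descendingWithout2-↭ (suc m))))
    (rotate-2∷descendingWithout2-allPV isEven 2 m even)

  witness-not-image : ∀ {π} → π ∈ filterᵇ oddPeaksValleys (perms k) → rotate π ≢ witness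
  witness-not-image {π} π∈ eq with rotate-injective {π} {2 ∷ descendingWithout2 (suc m)} eq
  ... | refl =
    2∷descendingWithout2-peak-at-2 m (proj₂ (∈-filter⁻ (T? ∘ oddPeaksValleys) {xs = perms k} π∈))

proposition7 : (n : ℕ) → 1 ≤ n → c (2 * n + 1) < b (2 * n + 1)
proposition7 (suc n) _ =
  subst (λ k → c k < b k) (sym 2*[1+n]+1≡3+2*n) (c<b-when-2+m-even (2 * n) 2+2*n-even)
  where
  2+2*n-even : T (isEven (2 + 2 * n))
  2+2*n-even = subst (T ∘ isEven) (*-suc 2 n) (isEven-2* (suc n))
  2*[1+n]+1≡3+2*n : 2 * suc n + 1 ≡ 3 + 2 * n
  2*[1+n]+1≡3+2*n = ≡-trans (+-comm (2 * suc n) 1) (cong suc (*-suc 2 n))
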